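{- Let $a\geq 0$ and $b\geq 1$ be integers and $n=4a+2b+2$. Let $\alpha=(1,2,\dots,2a+b+1,\,3a+b+2,\,3a+b+3,\dots,3a+2b+1)$ and $\beta=(a+1,a+2,\dots,a+b,\,2a+b+2,\,2a+b+3,\dots,4a+2b+2)$ be cycles in the symmetric group on $\{1,2,\dots,n\}$ (the entries listed in the given order, each run consisting of consecutive integers). Then the permutation group generated by $\alpha$ and $\beta$ acts 2-transitively on $\{1,2,\dots,n\}$.
   Context: A permutation group $G$ on $\{1,\dots,n\}$ is 2-transitive if for all $x\neq y$ and $w\neq z$ in $\{1,\dots,n\}$ there is $\pi\in G$ with $\pi(x)=w$ and $\pi(y)=z$. A cycle $(s_1,s_2,\dots,s_k)$ maps $s_1\mapsto s_2\mapsto\cdots\mapsto s_k\mapsto s_1$ and fixes all other points. -}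

module Defs where

open import Data.Nat using (ℕ; _+_; _*_; _≡ᵇ_)
open import Data.Bool using (if_then_else_)
open import Data.List using (List; []; _∷_; _++_; map; upTo; reverse)
open import Data.List.Membership.Propositional using (_∈_)
open import Function using (_∘_; id)
open import Relation.Binary.PropositionalEquality using (_≡_)

-- Permutations of {1,…,n} are represented as functions ℕ → ℕ
-- (points outside {1,…,n} are fixed by all the permutations considered).

run : ℕ → ℕ → List ℕ
run m k = map (m +_) (upTo k)

-- cycle (s₁ … s_k): s₁ ↦ s₂ ↦ … ↦ s_k ↦ s₁, all other points fixed
private
  go : ℕ → List ℕ → ℕ → ℕ
  go f [] x = x
  go f (s ∷ []) x = if x ≡ᵇ s then f else x
  go f (s ∷ t ∷ rest) x = if x ≡ᵇ s then t else go f (t ∷ rest) x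

cycle : List ℕ → ℕ → ℕ
cycle [] x = x
cycle (s ∷ rest) x = go s (s ∷ rest) x

cycleInv : List ℕ → ℕ → ℕ
cycleInv l = cycle (reverse l)

αList : ℕ → ℕ → List ℕ
αList a b = run 1 (2 * a + b + 1) ++ run (3 * a + b + 2) b

βList : ℕ → ℕ → List ℕ
βList a b = run (a + 1) b ++ run (2 * a + b + 2) (2 * a + b + 1)

data InGenerated (cs : List (List ℕ)) : (ℕ → ℕ) → Set where
  gen-id  : InGenerated cs id
  gen-mul : ∀ {π} (c : List ℕ) → c ∈ cs → InGenerated cs π → InGenerated cs (cycle c ∘ π)
  gen-inv : ∀ {π} (c : List ℕ) → c ∈ cs → InGenerated cs π → InGenerated cs (cycleInv c ∘ π)

TwoTransitive : ℕ → ((ℕ → ℕ) → Set) → Set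
TwoTransitive n G =
  ∀ x y w z →
  1 ≤′ x → x ≤′ n → 1 ≤′ y → y ≤′ n → 1 ≤′ w → w ≤′ n → 1 ≤′ z → z ≤′ n →
  x ≢ y → w ≢ z →
  Σ (ℕ → ℕ) λ π → G π × π x ≡ w × π y ≡ z
  where
  open import Data.Nat using () renaming (_≤_ to _≤′_)
  open import Data.Product using (Σ; _×_)
  open import Relation.Binary.PropositionalEquality using (_≢_)

module Submission where

-- The group is transitive on {1,…,n} and the stabiliser of L = 2a+b+1 is transitive on the
-- remaining points, which gives 2-transitivity. Powers of α move 1, …, L to L; powers of β move
-- the long run 2a+b+2, …, n of β to its last entry n, which β sends to a+1 and α^(a+b) then to L.
-- In the stabiliser, β (which fixes L) carries the points of its own runs to n. The remaining
-- points, in [1, a] and [a+b+1, 2a+b], are moved by the conjugates α^j β α^-j with 1 ≤ j ≤ a: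
-- these still fix L because α^-j L = 2a+b+1-j lies between the two runs of β.

open import Defs
open import Data.Bool using (true; false; T)
open import Data.Empty using (⊥; ⊥-elim)
open import Data.List using (List; []; _∷_; _++_; [_]; reverse; map; upTo; applyUpTo)
open import Data.List.Membership.Propositional using (_∈_; _∉_)
open import Data.List.Membership.Propositional.Properties using (∈-∃++; ∈-++⁺ʳ; ∈-++⁻; ∈-applyUpTo⁻)
open import Data.List.Properties
  using (reverse-++; reverse-involutive; ++-assoc; ++-identityʳ; unfold-reverse; map-upTo; map-++; upTo-∷ʳ)
open import Data.List.Relation.Unary.All as All using (All; []; _∷_)
open import Data.List.Relation.Unary.AllPairs using ([]; _∷_)
import Data.List.Relation.Unary.AllPairs.Properties as AllPairs
open import Data.List.Relation.Unary.Any using (here; there)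
open import Data.List.Relation.Unary.Any.Properties using (reverse⁻)
open import Data.Nat using (ℕ; zero; suc; _+_; _*_; _∸_; _≤_; _<_; _≡ᵇ_; s≤s)
open import Data.Nat.Properties
  using (≡ᵇ⇒≡; _≟_; ≤-refl; ≤-reflexive; ≤-trans; <-trans; <-≤-trans; ≤-<-trans; ≤-pred; <⇒≱; n<1+n; n≤1+n;
         0<1+n; m≤n⇒m≤1+n; m≤m+n; m≤n+m; m+n≤o⇒m≤o; m+n≤o⇒m≤o∸n; m∸n≤m; m+[n∸m]≡n; m∸n+n≡m;
         +-comm; +-assoc; +-suc; +-identityʳ; +-cancelˡ-≡; +-cancelˡ-≤; +-monoʳ-≤; +-monoʳ-<)
open import Data.Nat.Tactic.RingSolver using (solve-∀)
open import Data.List.Membership.DecPropositional _≟_ using (_∈?_)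
open import Data.List.Relation.Unary.Unique.Propositional {A = ℕ} using (Unique)
open import Data.List.Relation.Unary.Unique.Propositional.Properties using (map⁺; upTo⁺; ++⁺)
open import Data.Product using (_×_; _,_; proj₁; proj₂; ∃-syntax)
open import Data.Sum using (_⊎_; inj₁; inj₂)
open import Data.Unit using (tt)
open import Function using (_∘_; id)
open import Function.Endo.Propositional ℕ using (_^_)
open import Relation.Binary.PropositionalEquality
  using (_≡_; _≢_; refl; sym; trans; cong; cong₂; subst; module ≡-Reasoning)
open import Relation.Nullary using (yes; no)

≡ᵇ-refl : ∀ x → (x ≡ᵇ x) ≡ true
≡ᵇ-refl zero    = refl
≡ᵇ-refl (suc x) = ≡ᵇ-refl x

≢⇒≡ᵇ-false : ∀ {x y} → x ≢ y → (x ≡ᵇ y) ≡ false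
≢⇒≡ᵇ-false {x} {y} x≢y with x ≡ᵇ y in eq
... | true  = ⊥-elim (x≢y (≡ᵇ⇒≡ x y (subst T (sym eq) tt)))
... | false = refl

cycle-head : ∀ s t r → cycle (s ∷ t ∷ r) s ≡ t
cycle-head s t r rewrite ≡ᵇ-refl s = refl

cycle-single : ∀ s → cycle [ s ] s ≡ s
cycle-single s rewrite ≡ᵇ-refl s = refl

∉-drop-second : ∀ {x f t} {r : List ℕ} → x ∉ f ∷ t ∷ r → x ∉ f ∷ r
∉-drop-second x∉ (here x≡f)  = x∉ (here x≡f)
∉-drop-second x∉ (there x∈r) = x∉ (there (there x∈r))

-- Removing the second entry is the induction step for evaluating `cycle` below, since the
-- private helper that `cycle` is defined with cannot be named here.
cycle-drop : ∀ {f t x} r → x ≢ f → x ≢ t → cycle (f ∷ t ∷ r) x ≡ cycle (f ∷ r) x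
cycle-drop []      x≢f x≢t rewrite ≢⇒≡ᵇ-false x≢f | ≢⇒≡ᵇ-false x≢t = refl
cycle-drop (_ ∷ _) x≢f x≢t rewrite ≢⇒≡ᵇ-false x≢f | ≢⇒≡ᵇ-false x≢t = refl

cycle-next : ∀ xs {s t} ys → s ∉ xs → cycle (xs ++ s ∷ t ∷ ys) s ≡ t
cycle-next []           {s} {t} ys s∉ = cycle-head s t ys
cycle-next (h ∷ [])     {s}     ys s∉ rewrite ≢⇒≡ᵇ-false (s∉ ∘ here) | ≡ᵇ-refl s = refl
cycle-next (h ∷ h′ ∷ xs) {s} {t} ys s∉ =
  trans (cycle-drop (xs ++ s ∷ t ∷ ys) (s∉ ∘ here) (s∉ ∘ there ∘ here))
        (cycle-next (h ∷ xs) ys (∉-drop-second s∉))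

cycle-last : ∀ {h} xs {s} → s ∉ h ∷ xs → cycle (h ∷ xs ++ [ s ]) s ≡ h
cycle-last []        {s} s∉ rewrite ≢⇒≡ᵇ-false (s∉ ∘ here) | ≡ᵇ-refl s = refl
cycle-last (h′ ∷ xs) {s} s∉ =
  trans (cycle-drop (xs ++ [ s ]) (s∉ ∘ here) (s∉ ∘ there ∘ here))
        (cycle-last xs (∉-drop-second s∉))

cycle-fix : ∀ l {x} → x ∉ l → cycle l x ≡ x
cycle-fix []          x∉ = refl
cycle-fix (s ∷ [])    x∉ rewrite ≢⇒≡ᵇ-false (x∉ ∘ here) = refl
cycle-fix (f ∷ t ∷ r) x∉ =
  trans (cycle-drop r (x∉ ∘ here) (x∉ ∘ there ∘ here))
        (cycle-fix (f ∷ r) (∉-drop-second x∉))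

cycle-preserves : ∀ {P : ℕ → Set} l {x} → All P l → P x → P (cycle l x)
cycle-preserves []                  _         px = px
cycle-preserves {P} (f ∷ r) {x} (pf ∷ pr) px = after-head r pr
  where
  after-head : ∀ r → All P r → P (cycle (f ∷ r) x)
  after-head [] [] with x ≡ᵇ f
  ... | true  = pf
  ... | false = px
  after-head (t ∷ r) (pt ∷ pr) with x ≟ f | x ≟ t
  ... | yes refl | _ = subst P (sym (cycle-head x t r)) pt
  after-head (t ∷ []) _ | no x≢f | yes refl =
    subst P (sym (cycle-last [] λ { (here x≡f) → x≢f x≡f })) pf
  after-head (t ∷ u ∷ r) (_ ∷ pu ∷ _) | no x≢f | yes refl =
    subst P (sym (cycle-next [ f ] r λ { (here x≡f) → x≢f x≡f })) pu
  after-head (t ∷ r) (pt ∷ pr) | no x≢f | no x≢t =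
    subst P (sym (cycle-drop r x≢f x≢t)) (after-head r pr)

Unique[xs++x∷ys]⇒x∉xs : ∀ xs {x ys} → Unique (xs ++ x ∷ ys) → x ∉ xs
Unique[xs++x∷ys]⇒x∉xs (h ∷ xs) (h≢ ∷ _) (here x≡h)  = All.lookup h≢ (∈-++⁺ʳ xs (here refl)) (sym x≡h)
Unique[xs++x∷ys]⇒x∉xs (h ∷ xs) (_ ∷ u)  (there x∈xs) = Unique[xs++x∷ys]⇒x∉xs xs u x∈xs

Unique-reverse : ∀ {xs} → Unique xs → Unique (reverse xs)
Unique-reverse {[]}     []       = []
Unique-reverse {x ∷ xs} (x≢ ∷ u) = subst Unique (sym (unfold-reverse x xs))
  (AllPairs.++⁺ (Unique-reverse u) ([] ∷ []) (All.tabulate λ y∈ → y≢x y∈ ∷ []))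
  where
  y≢x : ∀ {y} → y ∈ reverse xs → y ≢ x
  y≢x y∈ y≡x = All.lookup x≢ (reverse⁻ y∈) (sym y≡x)

reverse-sandwich : ∀ (xs ms ys : List ℕ) → reverse (xs ++ ms ++ ys) ≡ reverse ys ++ reverse ms ++ reverse xs
reverse-sandwich xs ms ys = begin
  reverse (xs ++ ms ++ ys)              ≡⟨ reverse-++ xs (ms ++ ys) ⟩
  reverse (ms ++ ys) ++ reverse xs      ≡⟨ cong (_++ reverse xs) (reverse-++ ms ys) ⟩
  (reverse ys ++ reverse ms) ++ reverse xs ≡⟨ ++-assoc (reverse ys) (reverse ms) (reverse xs) ⟩
  reverse ys ++ reverse ms ++ reverse xs ∎
  where open ≡-Reasoning

cycle-reverse-cancel : ∀ {l} → Unique l → ∀ x → cycle (reverse l) (cycle l x) ≡ x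
cycle-reverse-cancel {l} u x with x ∈? l
... | no x∉l = trans (cong (cycle (reverse l)) (cycle-fix l x∉l)) (cycle-fix (reverse l) (x∉l ∘ reverse⁻))
... | yes x∈l with ∈-∃++ x∈l
...   | xs , ys , refl = at xs ys u
  where
  at : ∀ xs ys → Unique (xs ++ x ∷ ys) → cycle (reverse (xs ++ x ∷ ys)) (cycle (xs ++ x ∷ ys) x) ≡ x
  at [] [] _ = trans (cong (cycle [ x ]) (cycle-single x)) (cycle-single x)
  at xs (t ∷ ys) u =
    trans (cong₂ cycle (reverse-sandwich xs (x ∷ t ∷ []) ys) (cycle-next xs ys (Unique[xs++x∷ys]⇒x∉xs xs u)))
          (cycle-next (reverse ys) (reverse xs) (Unique[xs++x∷ys]⇒x∉xs (reverse ys) u′))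
    where
    u′ : Unique (reverse ys ++ t ∷ x ∷ reverse xs)
    u′ = subst Unique (reverse-sandwich xs (x ∷ t ∷ []) ys) (Unique-reverse u)
  at (h ∷ xs) [] u =
    trans (cong₂ cycle (reverse-sandwich [ h ] xs [ x ]) (cycle-last xs (Unique[xs++x∷ys]⇒x∉xs (h ∷ xs) u)))
          (cycle-last (reverse xs) (Unique[xs++x∷ys]⇒x∉xs (x ∷ reverse xs) u′))
    where
    u′ : Unique (x ∷ reverse xs ++ [ h ])
    u′ = subst Unique (reverse-sandwich [ h ] xs [ x ]) (Unique-reverse u)

cycle-cancel-reverse : ∀ {l} → Unique l → ∀ x → cycle l (cycle (reverse l) x) ≡ x
cycle-cancel-reverse {l} u = subst (λ l′ → ∀ x → cycle l′ (cycle (reverse l) x) ≡ x)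
  (reverse-involutive l) (cycle-reverse-cancel (Unique-reverse u))

module _ {cs : List (List ℕ)} where

  InGenerated-∘ : ∀ {π σ} → InGenerated cs π → InGenerated cs σ → InGenerated cs (π ∘ σ)
  InGenerated-∘ gen-id           gσ = gσ
  InGenerated-∘ (gen-mul c c∈ g) gσ = gen-mul c c∈ (InGenerated-∘ g gσ)
  InGenerated-∘ (gen-inv c c∈ g) gσ = gen-inv c c∈ (InGenerated-∘ g gσ)

  InGenerated-^ : ∀ {π} → InGenerated cs π → ∀ k → InGenerated cs (π ^ k)
  InGenerated-^ g zero    = gen-id
  InGenerated-^ g (suc k) = InGenerated-∘ g (InGenerated-^ g k)

  InGenerated-cycle : ∀ {c} → c ∈ cs → InGenerated cs (cycle c)
  InGenerated-cycle {c} c∈ = gen-mul c c∈ gen-id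

  InGenerated-preserves : ∀ {P : ℕ → Set} → All (All P) cs →
                          ∀ {π} → InGenerated cs π → ∀ {x} → P x → P (π x)
  InGenerated-preserves supp gen-id           px = px
  InGenerated-preserves supp (gen-mul c c∈ g) px =
    cycle-preserves c (All.lookup supp c∈) (InGenerated-preserves supp g px)
  InGenerated-preserves supp (gen-inv c c∈ g) px =
    cycle-preserves (reverse c) (All.tabulate (All.lookup (All.lookup supp c∈) ∘ reverse⁻))
                    (InGenerated-preserves supp g px)

  InGenerated-left-inverse : All Unique cs → ∀ {π} → InGenerated cs π →
                             ∃[ σ ] InGenerated cs σ × (∀ x → σ (π x) ≡ x)
  InGenerated-left-inverse uniq gen-id = id , gen-id , λ _ → refl
  InGenerated-left-inverse uniq (gen-mul c c∈ g) with InGenerated-left-inverse uniq g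
  ... | σ , gσ , σπ = σ ∘ cycleInv c , InGenerated-∘ gσ (gen-inv c c∈ gen-id) ,
                      λ x → trans (cong σ (cycle-reverse-cancel (All.lookup uniq c∈) _)) (σπ x)
  InGenerated-left-inverse uniq (gen-inv c c∈ g) with InGenerated-left-inverse uniq g
  ... | σ , gσ , σπ = σ ∘ cycle c , InGenerated-∘ gσ (InGenerated-cycle c∈) ,
                      λ x → trans (cong σ (cycle-cancel-reverse (All.lookup uniq c∈) _)) (σπ x)

  InGenerated-conjugate : All Unique cs → ∀ {π τ} → InGenerated cs π → InGenerated cs τ →
                          ∃[ δ ] InGenerated cs δ × (∀ u → δ (π u) ≡ π (τ u))
  InGenerated-conjugate uniq {π} {τ} gπ gτ with InGenerated-left-inverse uniq gπ
  ... | σ , gσ , σπ = π ∘ τ ∘ σ , InGenerated-∘ gπ (InGenerated-∘ gτ gσ) , λ u → cong (π ∘ τ) (σπ u)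

InRange : ℕ → ℕ → Set
InRange n x = 1 ≤ x × x ≤ n

module _ {cs : List (List ℕ)} {n : ℕ} (uniq : All Unique cs) (supp : All (All (InRange n)) cs)
         (p q : ℕ)
         (to-p : ∀ x → InRange n x → ∃[ π ] InGenerated cs π × π x ≡ p)
         (stab : ∀ y → InRange n y → y ≢ p → ∃[ π ] InGenerated cs π × π p ≡ p × π y ≡ q)
         where

  to-pq : ∀ x y → InRange n x → InRange n y → x ≢ y →
          ∃[ π ] InGenerated cs π × π x ≡ p × π y ≡ q
  to-pq x y x∈ y∈ x≢y with to-p x x∈
  ... | τ , gτ , τx≡p with InGenerated-left-inverse uniq gτ
  ...   | τ⁻ , _ , τ⁻τ with stab (τ y) (InGenerated-preserves supp gτ y∈) τy≢p
    where
    τy≢p : τ y ≢ p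
    τy≢p τy≡p = x≢y (trans (sym (τ⁻τ x)) (trans (cong τ⁻ (trans τx≡p (sym τy≡p))) (τ⁻τ y)))
  ...     | σ , gσ , σp≡p , στy≡q = σ ∘ τ , InGenerated-∘ gσ gτ , trans (cong σ τx≡p) σp≡p , στy≡q

  two-transitive-from-stabiliser : TwoTransitive n (InGenerated cs)
  two-transitive-from-stabiliser x y w z lx ux ly uy lw uw lz uz x≢y w≢z
    with to-pq x y (lx , ux) (ly , uy) x≢y | to-pq w z (lw , uw) (lz , uz) w≢z
  ... | π , gπ , πx≡p , πy≡q | ρ , gρ , ρw≡p , ρz≡q with InGenerated-left-inverse uniq gρ
  ...   | ρ⁻ , gρ⁻ , ρ⁻ρ = ρ⁻ ∘ π , InGenerated-∘ gρ⁻ gπ ,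
                           trans (cong ρ⁻ (trans πx≡p (sym ρw≡p))) (ρ⁻ρ w) ,
                           trans (cong ρ⁻ (trans πy≡q (sym ρz≡q))) (ρ⁻ρ z)

^-suc′ : ∀ (g : ℕ → ℕ) k x → (g ^ suc k) x ≡ (g ^ k) (g x)
^-suc′ g zero    x = refl
^-suc′ g (suc k) x = cong g (^-suc′ g k x)

^-fix : ∀ g {x} → g x ≡ x → ∀ k → (g ^ k) x ≡ x
^-fix g gx≡x zero    = refl
^-fix g gx≡x (suc k) = trans (cong g (^-fix g gx≡x k)) gx≡x

^-shift : ∀ {g f : ℕ → ℕ} {k} → (∀ {i} → suc i < k → g (f i) ≡ f (suc i)) →
          ∀ i j → i + j < k → (g ^ j) (f i) ≡ f (i + j)
^-shift {f = f} step i zero    _ = cong f (sym (+-identityʳ i))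
^-shift {g} {f} {k} step i (suc j) i+1+j<k = begin
  g ((g ^ j) (f i)) ≡⟨ cong g (^-shift step i j (<-trans (n<1+n _) i+j<k)) ⟩
  g (f (i + j))     ≡⟨ step i+j<k ⟩
  f (suc (i + j))   ≡⟨ cong f (sym (+-suc i j)) ⟩
  f (i + suc j)     ∎
  where
  open ≡-Reasoning
  i+j<k : suc (i + j) < k
  i+j<k = subst (_< k) (+-suc i j) i+1+j<k

∈-run⁻ : ∀ m k {v} → v ∈ run m k → m ≤ v × v < m + k
∈-run⁻ m k v∈ with ∈-applyUpTo⁻ (m +_) (subst (_ ∈_) (map-upTo (m +_) k) v∈)
... | i , i<k , refl = m≤m+n m i , +-monoʳ-< m i<k

Unique-run : ∀ m k → Unique (run m k)
Unique-run m k = map⁺ (+-cancelˡ-≡ m _ _) (upTo⁺ k)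

run-∷ʳ : ∀ m k → run m (suc k) ≡ run m k ++ [ m + k ]
run-∷ʳ m k = trans (cong (map (m +_)) (sym (upTo-∷ʳ k))) (map-++ (m +_) (upTo k) [ k ])

cycle-applyUpTo-step : ∀ P f Q {k i} → Unique (P ++ applyUpTo f k ++ Q) → suc i < k →
                       cycle (P ++ applyUpTo f k ++ Q) (f i) ≡ f (suc i)
cycle-applyUpTo-step P f Q {suc (suc k)} {zero} u _ = cycle-next P _ (Unique[xs++x∷ys]⇒x∉xs P u)
cycle-applyUpTo-step P f Q {suc k} {suc i} u (s≤s i<k) =
  subst (λ l → Unique l → cycle l (f (suc i)) ≡ f (suc (suc i)))
        (++-assoc P [ f 0 ] (applyUpTo (f ∘ suc) k ++ Q))
        (λ u′ → cycle-applyUpTo-step (P ++ [ f 0 ]) (f ∘ suc) Q u′ i<k) u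

cycle-run-step : ∀ P m Q {k i} → Unique (P ++ run m k ++ Q) → suc i < k →
                 cycle (P ++ run m k ++ Q) (m + i) ≡ m + suc i
cycle-run-step P m Q {k} {i} =
  subst (λ r → Unique (P ++ r ++ Q) → suc i < k → cycle (P ++ r ++ Q) (m + i) ≡ m + suc i)
        (sym (map-upTo (m +_) k)) (cycle-applyUpTo-step P (m +_) Q)

module CycleOfTwoRuns (m k m′ k′ : ℕ) (gap : m + suc k ≤ m′) where

  runs : List ℕ
  runs = run m (suc k) ++ run m′ (suc k′)

  σ : ℕ → ℕ
  σ = cycle runs

  ∈-runs⁻ : ∀ {v} → v ∈ runs → m ≤ v × v < m′ + suc k′
  ∈-runs⁻ v∈ with ∈-++⁻ (run m (suc k)) v∈
  ... | inj₁ v∈₁ = proj₁ (∈-run⁻ m (suc k) v∈₁) ,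
                   <-≤-trans (proj₂ (∈-run⁻ m (suc k) v∈₁)) (≤-trans gap (m≤m+n m′ (suc k′)))
  ... | inj₂ v∈₂ = ≤-trans (m+n≤o⇒m≤o m gap) (proj₁ (∈-run⁻ m′ (suc k′) v∈₂)) ,
                   proj₂ (∈-run⁻ m′ (suc k′) v∈₂)

  unique : Unique runs
  unique = ++⁺ (Unique-run m _) (Unique-run m′ _)
    λ (v∈₁ , v∈₂) → <⇒≱ (proj₂ (∈-run⁻ m (suc k) v∈₁)) (≤-trans gap (proj₁ (∈-run⁻ m′ (suc k′) v∈₂)))

  fix-between : ∀ {v} → m + suc k ≤ v → v < m′ → σ v ≡ v
  fix-between {v} v≥ v< = cycle-fix runs λ v∈ → in-neither (∈-++⁻ (run m (suc k)) v∈)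
    where
    in-neither : v ∈ run m (suc k) ⊎ v ∈ run m′ (suc k′) → ⊥
    in-neither (inj₁ v∈₁) = <⇒≱ (proj₂ (∈-run⁻ m (suc k) v∈₁)) v≥
    in-neither (inj₂ v∈₂) = <⇒≱ v< (proj₁ (∈-run⁻ m′ (suc k′) v∈₂))

  fix-above : ∀ {v} → m′ + suc k′ ≤ v → σ v ≡ v
  fix-above v≥ = cycle-fix runs λ v∈ → <⇒≱ (proj₂ (∈-runs⁻ v∈)) v≥

  iterate₁ : ∀ i j → i + j < suc k → (σ ^ j) (m + i) ≡ m + (i + j)
  iterate₁ = ^-shift (cycle-run-step [] m (run m′ (suc k′)) unique)

  step₂ : ∀ {i} → suc i < suc k′ → σ (m′ + i) ≡ m′ + suc i
  step₂ {i} = subst (λ l → Unique l → suc i < suc k′ → cycle l (m′ + i) ≡ m′ + suc i)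
                    (cong (run m (suc k) ++_) (++-identityʳ _))
                    (cycle-run-step (run m (suc k)) m′ []) unique

  iterate₂ : ∀ i j → i + j < suc k′ → (σ ^ j) (m′ + i) ≡ m′ + (i + j)
  iterate₂ = ^-shift step₂

  to-end₁ : ∀ {i} → i ≤ k → (σ ^ (k ∸ i)) (m + i) ≡ m + k
  to-end₁ {i} i≤k =
    trans (iterate₁ i (k ∸ i) (s≤s (≤-reflexive (m+[n∸m]≡n i≤k)))) (cong (m +_) (m+[n∸m]≡n i≤k))

  to-end₂ : ∀ {i} → i ≤ k′ → (σ ^ (k′ ∸ i)) (m′ + i) ≡ m′ + k′
  to-end₂ {i} i≤k′ =
    trans (iterate₂ i (k′ ∸ i) (s≤s (≤-reflexive (m+[n∸m]≡n i≤k′)))) (cong (m′ +_) (m+[n∸m]≡n i≤k′))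

  end₁↦start₂ : σ (m + k) ≡ m′ + 0
  end₁↦start₂ = subst (λ l → Unique l → cycle l (m + k) ≡ m′ + 0) (sym split)
    (λ u → cycle-next (run m k) _ (Unique[xs++x∷ys]⇒x∉xs (run m k) u)) unique
    where
    split : runs ≡ run m k ++ (m + k) ∷ run m′ (suc k′)
    split = trans (cong (_++ run m′ (suc k′)) (run-∷ʳ m k)) (++-assoc (run m k) _ _)

  end₂↦start₁ : σ (m′ + k′) ≡ m + 0
  end₂↦start₁ = subst (λ l → Unique l → cycle l (m′ + k′) ≡ m + 0) (sym split)
    (λ u → cycle-last middle (Unique[xs++x∷ys]⇒x∉xs (m + 0 ∷ middle) u)) unique
    where
    middle : List ℕ
    middle = map (m +_) (applyUpTo suc k) ++ run m′ k′
    split : runs ≡ (m + 0) ∷ middle ++ [ m′ + k′ ]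
    split = trans (cong (run m (suc k) ++_) (run-∷ʳ m′ k′)) (sym (++-assoc (run m (suc k)) _ _))

<⊎offset : ∀ m i → i < m ⊎ ∃[ o ] i ≡ m + o
<⊎offset zero    i       = inj₂ (i , refl)
<⊎offset (suc m) zero    = inj₁ 0<1+n
<⊎offset (suc m) (suc i) with <⊎offset m i
... | inj₁ i<m        = inj₁ (s≤s i<m)
... | inj₂ (o , refl) = inj₂ (o , refl)

module Generators (a c : ℕ) where

  private
    length≡ : ∀ a c → 2 * a + suc c + 1 ≡ suc (a + suc c + a)
    length≡ = solve-∀
    αstart≡ : ∀ a c → 3 * a + suc c + 2 ≡ suc (suc (a + suc c + a)) + a
    αstart≡ = solve-∀
    βstart≡ : ∀ a c → 2 * a + suc c + 2 ≡ suc (suc (a + suc c + a))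
    βstart≡ = solve-∀
    αend≡ : ∀ a c → suc (suc (a + suc c + a)) + a + suc c + suc a ≡ suc (4 * a + 2 * suc c + 2)
    αend≡ = solve-∀
    βend≡ : ∀ a c → suc (suc (a + suc c + a)) + suc (a + suc c + a) ≡ suc (4 * a + 2 * suc c + 2)
    βend≡ = solve-∀
    n≡ : ∀ a c → 4 * a + 2 * suc c + 2 ≡ suc (suc (a + suc c + a)) + (a + suc c + a)
    n≡ = solve-∀
    L-offset : ∀ a c → a + (suc c + (a + 0)) ≡ a + suc c + a
    L-offset = solve-∀
    top-offset : ∀ a c o → suc (a + (suc c + (a + suc o))) ≡ suc (suc (a + suc c + a)) + o
    top-offset = solve-∀

  -- In this notation α = (1 … L, N … N + c) and β = (a+1 … a+b, M … M + K); the stabiliser of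
  -- L = 2a+b+1 is used, and M + K is the last point n.
  b K L M N n : ℕ
  b = suc c
  K = a + b + a
  L = suc K
  M = suc L
  N = M + a
  n = 4 * a + 2 * b + 2

  module A = CycleOfTwoRuns 1 K N c (m≤m+n M a)
  module B = CycleOfTwoRuns (suc a) c M K (s≤s (m≤n⇒m≤1+n (m≤m+n (a + b) a)))

  α β : ℕ → ℕ
  α = A.σ
  β = B.σ

  αList≡ : αList a b ≡ A.runs
  αList≡ rewrite length≡ a c | αstart≡ a c = refl

  βList≡ : βList a b ≡ B.runs
  βList≡ rewrite +-comm a 1 | length≡ a c | βstart≡ a c = refl

  gens : List (List ℕ)
  gens = αList a b ∷ βList a b ∷ []

  G : (ℕ → ℕ) → Set
  G = InGenerated gens

  α∈G : G α
  α∈G = subst G (cong cycle αList≡) (InGenerated-cycle (here refl))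

  β∈G : G β
  β∈G = subst G (cong cycle βList≡) (InGenerated-cycle (there (here refl)))

  unique : All Unique gens
  unique = subst Unique (sym αList≡) A.unique ∷ subst Unique (sym βList≡) B.unique ∷ []

  support : All (All (InRange n)) gens
  support = subst (All (InRange n)) (sym αList≡)
              (All.tabulate (in-range ≤-refl (m+n≤o⇒m≤o (N + b) (≤-reflexive (αend≡ a c))) ∘ A.∈-runs⁻))
          ∷ subst (All (InRange n)) (sym βList≡)
              (All.tabulate (in-range 0<1+n (≤-reflexive (βend≡ a c)) ∘ B.∈-runs⁻))
          ∷ []
    where
    in-range : ∀ {m u v} → 1 ≤ m → u ≤ suc n → m ≤ v × v < u → InRange n v
    in-range 1≤m u≤ (m≤v , v<u) = ≤-trans 1≤m m≤v , ≤-pred (<-≤-trans v<u u≤)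

  offset≤K : ∀ {o} → M + o ≤ n → o ≤ K
  offset≤K {o} M+o≤n = +-cancelˡ-≤ M o K (subst (M + o ≤_) (n≡ a c) M+o≤n)

  K≡a+[b+a] : a + (b + a) ≡ K
  K≡a+[b+a] = sym (+-assoc a b a)

  to-L : ∀ x → InRange n x → ∃[ π ] G π × π x ≡ L
  to-L (suc i) (_ , x≤n) with <⊎offset L i
  ... | inj₁ (s≤s i≤K) = α ^ (K ∸ i) , InGenerated-^ α∈G (K ∸ i) , A.to-end₁ i≤K
  ... | inj₂ (o , refl) = (α ^ (b + a)) ∘ β ∘ (β ^ (K ∸ o)) ,
    InGenerated-∘ (InGenerated-^ α∈G (b + a)) (InGenerated-∘ β∈G (InGenerated-^ β∈G (K ∸ o))) , chain
    where
    chain : (α ^ (b + a)) (β ((β ^ (K ∸ o)) (M + o))) ≡ L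
    chain = begin
      (α ^ (b + a)) (β ((β ^ (K ∸ o)) (M + o))) ≡⟨ cong ((α ^ (b + a)) ∘ β) (B.to-end₂ (offset≤K x≤n)) ⟩
      (α ^ (b + a)) (β (M + K))                 ≡⟨ cong (α ^ (b + a)) (trans B.end₂↦start₁ (cong suc (+-identityʳ a))) ⟩
      (α ^ (b + a)) (1 + a)                     ≡⟨ A.iterate₁ a (b + a) (s≤s (≤-reflexive K≡a+[b+a])) ⟩
      1 + (a + (b + a))                         ≡⟨ cong suc K≡a+[b+a] ⟩
      L                                         ∎
      where open ≡-Reasoning

  a≤K : a ≤ K
  a≤K = m≤n+m a (a + b)

  suc[a+c]+a≡K : suc (a + c) + a ≡ K
  suc[a+c]+a≡K = cong (_+ a) (sym (+-suc a c))

  suc[a+c]+a<L : suc (a + c) + a < L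
  suc[a+c]+a<L = s≤s (≤-reflexive suc[a+c]+a≡K)

  β-fixes-L : β L ≡ L
  β-fixes-L = B.fix-between (s≤s (m≤m+n (a + b) a)) (n<1+n L)

  βᵏ-fixes-L : ∀ k → (β ^ k) L ≡ L
  βᵏ-fixes-L = ^-fix β β-fixes-L

  Sends-to-top : ℕ → Set
  Sends-to-top y = ∃[ π ] G π × π L ≡ L × π y ≡ M + K

  -- suc (K ∸ j) = α^-j L lies strictly between the two runs of β.
  conjugate-fixing-L : ∀ j → j ≤ a → ∃[ δ ] G δ × δ L ≡ L × (∀ u → δ ((α ^ j) u) ≡ (α ^ j) (β u))
  conjugate-fixing-L j j≤a with InGenerated-conjugate unique (InGenerated-^ α∈G j) β∈G
  ... | δ , gδ , δα≡αβ = δ , gδ , δL≡L , δα≡αβ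
    where
    j≤K : j ≤ K
    j≤K = ≤-trans j≤a a≤K
    αʲ-p≡L : (α ^ j) (suc (K ∸ j)) ≡ L
    αʲ-p≡L = trans (A.iterate₁ (K ∸ j) j (s≤s (≤-reflexive (m∸n+n≡m j≤K)))) (cong suc (m∸n+n≡m j≤K))
    β-fixes-p : β (suc (K ∸ j)) ≡ suc (K ∸ j)
    β-fixes-p = B.fix-between (s≤s (m+n≤o⇒m≤o∸n (a + b) (+-monoʳ-≤ (a + b) j≤a))) (s≤s (s≤s (m∸n≤m K j)))
    δL≡L : δ L ≡ L
    δL≡L = begin
      δ L                           ≡⟨ cong δ (sym αʲ-p≡L) ⟩
      δ ((α ^ j) (suc (K ∸ j)))     ≡⟨ δα≡αβ (suc (K ∸ j)) ⟩
      (α ^ j) (β (suc (K ∸ j)))     ≡⟨ cong (α ^ j) β-fixes-p ⟩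
      (α ^ j) (suc (K ∸ j))         ≡⟨ αʲ-p≡L ⟩
      L                             ∎
      where open ≡-Reasoning

  via-conjugate : ∀ j k {u y} → j ≤ a → (α ^ j) u ≡ y → (β ^ k) ((α ^ j) (β u)) ≡ M + K → Sends-to-top y
  via-conjugate j k {u} j≤a αʲu≡y top with conjugate-fixing-L j j≤a
  ... | δ , gδ , δL≡L , δα≡αβ = (β ^ k) ∘ δ , InGenerated-∘ (InGenerated-^ β∈G k) gδ ,
    trans (cong (β ^ k) δL≡L) (βᵏ-fixes-L k) ,
    trans (cong ((β ^ k) ∘ δ) (sym αʲu≡y)) (trans (cong (β ^ k) (δα≡αβ u)) top)

  sends-first-block : ∀ i → i < a → Sends-to-top (suc i)
  sends-first-block i i<a = via-conjugate (suc i) a i<a αʲ≡ top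
    where
    αʲ≡ : (α ^ suc i) (N + c) ≡ suc i
    αʲ≡ = trans (^-suc′ α i (N + c))
                (trans (cong (α ^ i) A.end₂↦start₁) (A.iterate₁ 0 i (≤-trans i<a (m≤n⇒m≤1+n a≤K))))
    top : (β ^ a) ((α ^ suc i) (β (N + c))) ≡ M + K
    top = begin
      (β ^ a) ((α ^ suc i) (β (N + c)))       ≡⟨ cong ((β ^ a) ∘ (α ^ suc i)) β-last-of-α ⟩
      (β ^ a) ((α ^ suc i) (M + suc (a + c)))  ≡⟨ cong (β ^ a) (^-fix α α-fixes (suc i)) ⟩
      (β ^ a) (M + suc (a + c))                ≡⟨ B.iterate₂ (suc (a + c)) a suc[a+c]+a<L ⟩
      M + (suc (a + c) + a)                    ≡⟨ cong (M +_) suc[a+c]+a≡K ⟩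
      M + K                                    ∎
      where
      open ≡-Reasoning
      β-last-of-α : β (N + c) ≡ M + suc (a + c)
      β-last-of-α = trans (cong β (+-assoc M a c)) (B.step₂ (≤-<-trans (m≤m+n _ a) suc[a+c]+a<L))
      α-fixes : α (M + suc (a + c)) ≡ M + suc (a + c)
      α-fixes = A.fix-above (≤-reflexive (trans (+-assoc M a b) (cong (M +_) (+-suc a c))))

  sends-second-block : ∀ i → i < b → Sends-to-top (suc a + i)
  sends-second-block i (s≤s i≤c) = (β ^ K) ∘ β ∘ (β ^ (c ∸ i)) ,
    InGenerated-∘ (InGenerated-^ β∈G K) (InGenerated-∘ β∈G (InGenerated-^ β∈G (c ∸ i))) ,
    trans (cong ((β ^ K) ∘ β) (βᵏ-fixes-L (c ∸ i))) (trans (cong (β ^ K) β-fixes-L) (βᵏ-fixes-L K)) ,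
    top
    where
    top : (β ^ K) (β ((β ^ (c ∸ i)) (suc a + i))) ≡ M + K
    top = begin
      (β ^ K) (β ((β ^ (c ∸ i)) (suc a + i))) ≡⟨ cong ((β ^ K) ∘ β) (B.to-end₁ i≤c) ⟩
      (β ^ K) (β (suc a + c))                 ≡⟨ cong (β ^ K) B.end₁↦start₂ ⟩
      (β ^ K) (M + 0)                         ≡⟨ B.iterate₂ 0 K (n<1+n K) ⟩
      M + K                                   ∎
      where open ≡-Reasoning

  sends-third-block : ∀ i → i < a → Sends-to-top (suc (a + (b + i)))
  sends-third-block i i<a = via-conjugate (suc i) K i<a αʲ≡ top
    where
    αʲ≡ : (α ^ suc i) (suc (a + c)) ≡ suc (a + (b + i))
    αʲ≡ = trans (A.iterate₁ (a + c) (suc i) (s≤s a+c+suc[i]≤K))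
                (cong suc (trans (+-assoc a c (suc i)) (cong (a +_) (+-suc c i))))
      where
      a+c+suc[i]≤K : a + c + suc i ≤ K
      a+c+suc[i]≤K = ≤-trans (+-monoʳ-≤ (a + c) i<a) (≤-trans (n≤1+n _) (≤-reflexive suc[a+c]+a≡K))
    top : (β ^ K) ((α ^ suc i) (β (suc a + c))) ≡ M + K
    top = begin
      (β ^ K) ((α ^ suc i) (β (suc a + c))) ≡⟨ cong ((β ^ K) ∘ (α ^ suc i)) B.end₁↦start₂ ⟩
      (β ^ K) ((α ^ suc i) (M + 0))         ≡⟨ cong (β ^ K) (^-fix α α-fixes-M (suc i)) ⟩
      (β ^ K) (M + 0)                       ≡⟨ B.iterate₂ 0 K (n<1+n K) ⟩
      M + K                                 ∎
      where
      open ≡-Reasoning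
      α-fixes-M : α (M + 0) ≡ M + 0
      α-fixes-M = A.fix-between (m≤m+n M 0) (+-monoʳ-< M (<-≤-trans 0<1+n i<a))

  sends-top-run : ∀ o → o ≤ K → Sends-to-top (M + o)
  sends-top-run o o≤K = β ^ (K ∸ o) , InGenerated-^ β∈G (K ∸ o) , βᵏ-fixes-L (K ∸ o) , B.to-end₂ o≤K

  sends-to-top : ∀ y → InRange n y → y ≢ L → Sends-to-top y
  sends-to-top (suc i) (_ , y≤n) y≢L with <⊎offset a i
  ... | inj₁ i<a = sends-first-block i i<a
  ... | inj₂ (i₁ , refl) with <⊎offset b i₁
  ...   | inj₁ i₁<b = sends-second-block i₁ i₁<b
  ...   | inj₂ (i₂ , refl) with <⊎offset a i₂
  ...     | inj₁ i₂<a = sends-third-block i₂ i₂<a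
  ...     | inj₂ (zero , refl) = ⊥-elim (y≢L (cong suc (L-offset a c)))
  ...     | inj₂ (suc o , refl) = subst Sends-to-top (sym (top-offset a c o))
                                    (sends-top-run o (offset≤K (subst (_≤ n) (top-offset a c o) y≤n)))

lemma5 : (a b : ℕ) → 1 ≤ b →
    TwoTransitive (4 * a + 2 * b + 2) (InGenerated (αList a b ∷ βList a b ∷ []))
lemma5 a zero    ()
lemma5 a (suc c) _ = two-transitive-from-stabiliser unique support L (M + K) to-L sends-to-top
  where open Generators a c
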